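{- Let $S=\{(1,1),(1,2),(2,1)\}$. For all integers $\ell_1,\ell_2\ge 0$, $$a_S(\ell_1,\ell_2)=\sum_{k=0}^{\ell_1}\binom{k}{2k-\ell_1}\binom{2k-\ell_1}{\ell_2-k}.$$
   Context: For $S\subseteq\mathbb{N}^2$, $a_S(\ell_1,\ell_2)$ is the number of $2\times k$ matrices (over all $k\ge 0$) with non-negative integer entries whose first row sums to $\ell_1$, whose second row sums to $\ell_2$, and each of whose columns lies in $S$; for $(\ell_1,\ell_2)=(0,0)$ the empty matrix ($k=0$) is counted, so $a_S(0,0)=1$. Binomial coefficients $\binom{n}{m}$ with $n\ge 0$ are $0$ when $m<0$ or $m>n$. -}

module Defs where

open import Data.Nat using (ℕ; zero; suc; _+_; _*_)
open import Data.Nat.Combinatorics using (_C_)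
open import Data.Integer as ℤ using (ℤ; +_; -[1+_])
open import Data.Product using (Σ; _×_; _,_; proj₁; proj₂)
open import Data.List using (List; map)
open import Data.Nat.ListAction using (sum)
open import Data.List.Relation.Unary.All using (All)
open import Relation.Binary.PropositionalEquality using (_≡_)

-- A 2×k matrix with entries in ℕ is represented by the list of its k
-- columns, each column being a pair (top entry , bottom entry).
Mat : (ℕ × ℕ → Set) → ℕ → ℕ → Set
Mat S ℓ₁ ℓ₂ =
  Σ (List (ℕ × ℕ)) λ cols →
    All S cols × (sum (map proj₁ cols) ≡ ℓ₁) × (sum (map proj₂ cols) ≡ ℓ₂)

data S₀ : ℕ × ℕ → Set where
  c11 : S₀ (1 , 1)
  c12 : S₀ (1 , 2)
  c21 : S₀ (2 , 1)

-- Binomial coefficient with integer arguments: for n ≥ 0 it is the usual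
-- binomial (0 when m < 0 or m > n); for n < 0 we set it to 0 (this case
-- never matters in the theorem, since the top of the second binomial is
-- negative only when the first binomial already vanishes).
binomℤ : ℤ → ℤ → ℕ
binomℤ (+ n)    (+ m)      = n C m
binomℤ (+ n)    -[1+ _ ]   = 0
binomℤ -[1+ _ ] _          = 0

sumUpTo : ℕ → (ℕ → ℕ) → ℕ
sumUpTo zero    f = f 0
sumUpTo (suc n) f = sumUpTo n f + f (suc n)

rhs : ℕ → ℕ → ℕ
rhs ℓ₁ ℓ₂ = sumUpTo ℓ₁ λ k →
  binomℤ (+ k) (+ (2 * k) ℤ.- + ℓ₁)
    * binomℤ (+ (2 * k) ℤ.- + ℓ₁) (+ ℓ₂ ℤ.- + k)

module Submission where

-- A matrix with columns in S is a word in the three letters (1,1), (1,2),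
-- (2,1).  Such a word is encoded by a pair of binary strings: the top
-- string marks which columns have top entry 1, and the bottom string,
-- which has one entry per such column, marks which of them have bottom
-- entry 2.  If the word has k columns and row sums ℓ₁, ℓ₂, then the top
-- string has length k and 2k-ℓ₁ ones, and the bottom string has length
-- 2k-ℓ₁ and ℓ₂-k ones; conversely every such pair of strings arises.
-- Binary strings of length n with m ones are counted by C(n,m).

open import Defs
open import Data.Nat using (ℕ; zero; suc; _+_; _*_; _∸_; _≤_; _<_; z≤n; s≤s; _≤?_)
open import Data.Fin using (Fin)
import Data.Fin as F
open import Function.Bundles using (_↔_; mk↔ₛ′)

open import Data.Bool using (Bool; true; false)
open import Data.Empty using (⊥-elim)
open import Data.Fin.Properties using (+↔⊎; *↔×)
open import Data.Integer as ℤ using (+_)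
import Data.Integer.Properties as ℤ
open import Data.List using (List; []; _∷_; map; length; replicate)
open import Data.List.Properties using (length-replicate)
open import Data.List.Relation.Unary.All using (All; []; _∷_)
open import Data.Nat.Combinatorics using (_C_; nCk+nC[k+1]≡[n+1]C[k+1])
open import Data.Nat.ListAction using (sum)
open import Data.Nat.Properties
  using (≡-irrelevant; ≤-irrelevant; suc-injective; +-assoc; +-suc; *-zeroʳ;
         m≤m+n; m≤n⇒m≤1+n; ≤-trans; ≤-reflexive; ≰⇒>; m+[n∸m]≡n; m+n∸m≡n; +-cancelʳ-≡;
         m<n⇒0<n∸m)
open import Data.Product using (Σ; _×_; _,_; proj₁; proj₂)
open import Data.Product.Function.Dependent.Propositional using (Σ-↔)
open import Data.Product.Function.NonDependent.Propositional using (_×-↔_)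
open import Data.Sum using (_⊎_; inj₁; inj₂)
open import Data.Sum.Function.Propositional using (_⊎-↔_)
open import Function.Properties.Inverse using (↔-refl; ↔-sym; ↔-trans)
open import Function.Related.Propositional using (module EquationalReasoning)
open import Function.Related.TypeIsomorphisms using (Σ-assoc)
open import Relation.Binary.PropositionalEquality using (_≡_; refl; sym; trans; cong; cong₂)
open import Relation.Nullary using (Irrelevant; ¬_; yes; no)

open EquationalReasoning

subtype-≡ : {A : Set} {P : A → Set} → (∀ {a} → Irrelevant (P a)) →
            {x y : Σ A P} → proj₁ x ≡ proj₁ y → x ≡ y
subtype-≡ irr {a , p} {.a , q} refl = cong (a ,_) (irr p q)

×-irrelevant : {A B : Set} → Irrelevant A → Irrelevant B → Irrelevant (A × B)
×-irrelevant irrA irrB (a , b) (a′ , b′) = cong₂ _,_ (irrA a a′) (irrB b b′)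

empty-↔ : {A : Set} → ¬ A → Fin 0 ↔ A
empty-↔ ¬a = mk↔ₛ′ (λ ()) (λ a → ⊥-elim (¬a a)) (λ a → ⊥-elim (¬a a)) (λ ())

Fin-cong : {m n : ℕ} → m ≡ n → Fin m ↔ Fin n
Fin-cong refl = ↔-refl

≡-subject-↔ : {a b c : ℕ} → a ≡ b → (a ≡ c) ↔ (b ≡ c)
≡-subject-↔ refl = ↔-refl

-- Σ_{k ≤ n+1} f k = f 0 + Σ_{k ≤ n} f (k+1): peeling off the first term
-- follows the recursion of k ≤ n (z≤n / s≤s) rather than that of sumUpTo.
sumUpTo-suc : ∀ n (f : ℕ → ℕ) → sumUpTo (suc n) f ≡ f 0 + sumUpTo n (λ k → f (suc k))
sumUpTo-suc zero    f = refl
sumUpTo-suc (suc n) f =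
  trans (cong (_+ f (suc (suc n))) (sumUpTo-suc n f))
        (+-assoc (f 0) (sumUpTo n (λ k → f (suc k))) (f (suc (suc n))))

Σ≤-zero : {P : ℕ → Set} → Σ ℕ (λ k → k ≤ 0 × P k) ↔ P 0
Σ≤-zero {P} = mk↔ₛ′ (λ { (0 , z≤n , x) → x }) (λ x → 0 , z≤n , x) (λ _ → refl)
                    (λ { (0 , z≤n , x) → refl })

Σ≤-suc : {P : ℕ → Set} {n : ℕ} →
         Σ ℕ (λ k → k ≤ suc n × P k) ↔ (P 0 ⊎ Σ ℕ (λ k → k ≤ n × P (suc k)))
Σ≤-suc {P} {n} = mk↔ₛ′ to from to-from from-to
  where
  to : Σ ℕ (λ k → k ≤ suc n × P k) → P 0 ⊎ Σ ℕ (λ k → k ≤ n × P (suc k))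
  to (zero  , z≤n    , x) = inj₁ x
  to (suc k , s≤s le , x) = inj₂ (k , le , x)
  from : P 0 ⊎ Σ ℕ (λ k → k ≤ n × P (suc k)) → Σ ℕ (λ k → k ≤ suc n × P k)
  from (inj₁ x)            = 0 , z≤n , x
  from (inj₂ (k , le , x)) = suc k , s≤s le , x
  to-from : ∀ y → to (from y) ≡ y
  to-from (inj₁ x) = refl
  to-from (inj₂ y) = refl
  from-to : ∀ x → from (to x) ≡ x
  from-to (zero  , z≤n    , x) = refl
  from-to (suc k , s≤s le , x) = refl

sumUpTo-↔ : ∀ n (f : ℕ → ℕ) → Fin (sumUpTo n f) ↔ Σ ℕ (λ k → k ≤ n × Fin (f k))
sumUpTo-↔ zero    f = ↔-sym Σ≤-zero
sumUpTo-↔ (suc n) f = begin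
  Fin (sumUpTo (suc n) f)                                ↔⟨ Fin-cong (sumUpTo-suc n f) ⟩
  Fin (f 0 + sumUpTo n (λ k → f (suc k)))                ↔⟨ +↔⊎ ⟩
  (Fin (f 0) ⊎ Fin (sumUpTo n (λ k → f (suc k))))        ↔⟨ ↔-refl ⊎-↔ sumUpTo-↔ n (λ k → f (suc k)) ⟩
  (Fin (f 0) ⊎ Σ ℕ (λ k → k ≤ n × Fin (f (suc k))))      ↔⟨ Σ≤-suc ⟨
  Σ ℕ (λ k → k ≤ suc n × Fin (f k))                      ∎

partition-↔ : {X : Set} (size : X → ℕ) (Q : X → Set) {n : ℕ} → (∀ x → Q x → size x ≤ n) →
              Σ X Q ↔ Σ ℕ (λ k → k ≤ n × Σ X (λ x → size x ≡ k × Q x))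
partition-↔ {X} size Q {n} bounded = mk↔ₛ′ to from to-from (λ _ → refl)
  where
  to : Σ X Q → Σ ℕ (λ k → k ≤ n × Σ X (λ x → size x ≡ k × Q x))
  to (x , q) = size x , bounded x q , x , refl , q
  from : Σ ℕ (λ k → k ≤ n × Σ X (λ x → size x ≡ k × Q x)) → Σ X Q
  from (_ , _ , x , _ , q) = x , q
  to-from : ∀ y → to (from y) ≡ y
  to-from (_ , le , x , refl , q) = cong (λ le′ → size x , le′ , x , refl , q) (≤-irrelevant _ le)

ones : List Bool → ℕ
ones []           = 0
ones (true  ∷ bs) = suc (ones bs)
ones (false ∷ bs) = ones bs

BitStrings : ℕ → ℕ → Set
BitStrings n m = Σ (List Bool) λ bs → length bs ≡ n × ones bs ≡ m

bitStrings-≡ : {n m : ℕ} {x y : BitStrings n m} → proj₁ x ≡ proj₁ y → x ≡ y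
bitStrings-≡ = subtype-≡ (×-irrelevant ≡-irrelevant ≡-irrelevant)

ones-replicate-false : ∀ n → ones (replicate n false) ≡ 0
ones-replicate-false zero    = refl
ones-replicate-false (suc n) = ones-replicate-false n

no-ones : ∀ n (bs : List Bool) → length bs ≡ n → ones bs ≡ 0 → replicate n false ≡ bs
no-ones zero    []           refl _ = refl
no-ones (suc n) (false ∷ bs) len  o = cong (false ∷_) (no-ones n bs (suc-injective len) o)

bitStrings-zero : ∀ n → Fin 1 ↔ BitStrings n 0
bitStrings-zero n = mk↔ₛ′ (λ _ → all-false) (λ _ → F.zero) unique (λ { F.zero → refl ; (F.suc ()) })
  where
  all-false : BitStrings n 0
  all-false = replicate n false , length-replicate n , ones-replicate-false n
  unique : ∀ x → all-false ≡ x
  unique (bs , len , o) = bitStrings-≡ (no-ones n bs len o)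

bitStrings-pascal : ∀ n m → (BitStrings n m ⊎ BitStrings n (suc m)) ↔ BitStrings (suc n) (suc m)
bitStrings-pascal n m = mk↔ₛ′ to from to-from from-to
  where
  to : BitStrings n m ⊎ BitStrings n (suc m) → BitStrings (suc n) (suc m)
  to (inj₁ (bs , len , o)) = true  ∷ bs , cong suc len , cong suc o
  to (inj₂ (bs , len , o)) = false ∷ bs , cong suc len , o
  from : BitStrings (suc n) (suc m) → BitStrings n m ⊎ BitStrings n (suc m)
  from (true  ∷ bs , len , o) = inj₁ (bs , suc-injective len , suc-injective o)
  from (false ∷ bs , len , o) = inj₂ (bs , suc-injective len , o)
  to-from : ∀ y → to (from y) ≡ y
  to-from (true  ∷ _ , _) = bitStrings-≡ refl
  to-from (false ∷ _ , _) = bitStrings-≡ refl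
  from-to : ∀ x → from (to x) ≡ x
  from-to (inj₁ _) = cong inj₁ (bitStrings-≡ refl)
  from-to (inj₂ _) = cong inj₂ (bitStrings-≡ refl)

bitStrings-↔ : ∀ n m → Fin (n C m) ↔ BitStrings n m
bitStrings-↔ n       zero    = bitStrings-zero n
bitStrings-↔ zero    (suc m) = empty-↔ λ { ([] , _ , ()) }
bitStrings-↔ (suc n) (suc m) = begin
  Fin (suc n C suc m)                        ↔⟨ Fin-cong (nCk+nC[k+1]≡[n+1]C[k+1] n m) ⟨
  Fin (n C m + n C suc m)                    ↔⟨ +↔⊎ ⟩
  (Fin (n C m) ⊎ Fin (n C suc m))            ↔⟨ bitStrings-↔ n m ⊎-↔ bitStrings-↔ n (suc m) ⟩
  (BitStrings n m ⊎ BitStrings n (suc m))    ↔⟨ bitStrings-pascal n m ⟩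
  BitStrings (suc n) (suc m)                 ∎

data Column : Set where
  col11 col12 col21 : Column

entries : Column → ℕ × ℕ
entries col11 = 1 , 1
entries col12 = 1 , 2
entries col21 = 2 , 1

RowSums : ℕ → ℕ → List (ℕ × ℕ) → Set
RowSums ℓ₁ ℓ₂ cols = sum (map proj₁ cols) ≡ ℓ₁ × sum (map proj₂ cols) ≡ ℓ₂

Words : ℕ → ℕ → Set
Words ℓ₁ ℓ₂ = Σ (List Column) λ w → RowSums ℓ₁ ℓ₂ (map entries w)

entries∈S₀ : (w : List Column) → All S₀ (map entries w)
entries∈S₀ []          = []
entries∈S₀ (col11 ∷ w) = c11 ∷ entries∈S₀ w
entries∈S₀ (col12 ∷ w) = c12 ∷ entries∈S₀ w
entries∈S₀ (col21 ∷ w) = c21 ∷ entries∈S₀ w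

letters : {cols : List (ℕ × ℕ)} → All S₀ cols → List Column
letters []         = []
letters (c11 ∷ ps) = col11 ∷ letters ps
letters (c12 ∷ ps) = col12 ∷ letters ps
letters (c21 ∷ ps) = col21 ∷ letters ps

words↔columns : List Column ↔ Σ (List (ℕ × ℕ)) (All S₀)
words↔columns = mk↔ₛ′ (λ w → map entries w , entries∈S₀ w) (λ (_ , ps) → letters ps)
                      (λ (_ , ps) → entries-letters ps) letters-entries
  where
  cons : {c : ℕ × ℕ} → S₀ c → Σ (List (ℕ × ℕ)) (All S₀) → Σ (List (ℕ × ℕ)) (All S₀)
  cons {c} p (cols , ps) = c ∷ cols , p ∷ ps
  entries-letters : ∀ {cols} (ps : All S₀ cols) →
                    (map entries (letters ps) , entries∈S₀ (letters ps)) ≡ (cols , ps)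
  entries-letters []         = refl
  entries-letters (c11 ∷ ps) = cong (cons c11) (entries-letters ps)
  entries-letters (c12 ∷ ps) = cong (cons c12) (entries-letters ps)
  entries-letters (c21 ∷ ps) = cong (cons c21) (entries-letters ps)
  letters-entries : ∀ w → letters (entries∈S₀ w) ≡ w
  letters-entries []          = refl
  letters-entries (col11 ∷ w) = cong (col11 ∷_) (letters-entries w)
  letters-entries (col12 ∷ w) = cong (col12 ∷_) (letters-entries w)
  letters-entries (col21 ∷ w) = cong (col21 ∷_) (letters-entries w)

words↔matrices : ∀ ℓ₁ ℓ₂ → Words ℓ₁ ℓ₂ ↔ Mat S₀ ℓ₁ ℓ₂
words↔matrices ℓ₁ ℓ₂ =
  ↔-trans (Σ-↔ {B = λ c → RowSums ℓ₁ ℓ₂ (proj₁ c)} words↔columns ↔-refl) Σ-assoc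

Marking : Set
Marking = Σ (List Bool) λ top → Σ (List Bool) λ bottom → length bottom ≡ ones top

marking-≡ : {m m′ : Marking} → proj₁ m ≡ proj₁ m′ → proj₁ (proj₂ m) ≡ proj₁ (proj₂ m′) → m ≡ m′
marking-≡ {t , b , e} {.t , .b , e′} refl refl = cong (λ e″ → t , b , e″) (≡-irrelevant e e′)

topMarks : List Column → List Bool
topMarks []          = []
topMarks (col11 ∷ w) = true  ∷ topMarks w
topMarks (col12 ∷ w) = true  ∷ topMarks w
topMarks (col21 ∷ w) = false ∷ topMarks w

bottomMarks : List Column → List Bool
bottomMarks []          = []
bottomMarks (col11 ∷ w) = false ∷ bottomMarks w
bottomMarks (col12 ∷ w) = true  ∷ bottomMarks w
bottomMarks (col21 ∷ w) = bottomMarks w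

length-bottomMarks : ∀ w → length (bottomMarks w) ≡ ones (topMarks w)
length-bottomMarks []          = refl
length-bottomMarks (col11 ∷ w) = cong suc (length-bottomMarks w)
length-bottomMarks (col12 ∷ w) = cong suc (length-bottomMarks w)
length-bottomMarks (col21 ∷ w) = length-bottomMarks w

marks : List Column → Marking
marks w = topMarks w , bottomMarks w , length-bottomMarks w

-- Reading a word back off its marks; the length constraint excludes running
-- out of bottom marks, and is irrelevant to the result.
unmark : (top bottom : List Bool) → .(length bottom ≡ ones top) → List Column
unmark []           _           _ = []
unmark (false ∷ t)  b           e = col21 ∷ unmark t b e
unmark (true  ∷ t)  (false ∷ b) e = col11 ∷ unmark t b (suc-injective e)
unmark (true  ∷ t)  (true  ∷ b) e = col12 ∷ unmark t b (suc-injective e)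

topMarks-unmark : ∀ t b .(e : length b ≡ ones t) → topMarks (unmark t b e) ≡ t
topMarks-unmark []          _           _ = refl
topMarks-unmark (false ∷ t) b           e = cong (false ∷_) (topMarks-unmark t b e)
topMarks-unmark (true  ∷ t) (false ∷ b) e = cong (true ∷_) (topMarks-unmark t b (suc-injective e))
topMarks-unmark (true  ∷ t) (true  ∷ b) e = cong (true ∷_) (topMarks-unmark t b (suc-injective e))

bottomMarks-unmark : ∀ t b (e : length b ≡ ones t) → bottomMarks (unmark t b e) ≡ b
bottomMarks-unmark []          []          _ = refl
bottomMarks-unmark (false ∷ t) b           e = bottomMarks-unmark t b e
bottomMarks-unmark (true  ∷ t) (false ∷ b) e = cong (false ∷_) (bottomMarks-unmark t b (suc-injective e))
bottomMarks-unmark (true  ∷ t) (true  ∷ b) e = cong (true ∷_) (bottomMarks-unmark t b (suc-injective e))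

unmark-marks : ∀ w → unmark (topMarks w) (bottomMarks w) (length-bottomMarks w) ≡ w
unmark-marks []          = refl
unmark-marks (col11 ∷ w) = cong (col11 ∷_) (unmark-marks w)
unmark-marks (col12 ∷ w) = cong (col12 ∷_) (unmark-marks w)
unmark-marks (col21 ∷ w) = cong (col21 ∷_) (unmark-marks w)

word↔marking : List Column ↔ Marking
word↔marking = mk↔ₛ′ marks (λ (t , b , e) → unmark t b e)
  (λ (t , b , e) → marking-≡ (topMarks-unmark t b e) (bottomMarks-unmark t b e)) unmark-marks

topSum : List Bool → ℕ
topSum []          = 0
topSum (true  ∷ t) = suc (topSum t)
topSum (false ∷ t) = suc (suc (topSum t))

-- Row sums of a word in terms of its marks: each column contributes 1 to
-- the second row, plus 1 more if its bottom mark is true.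
MarkingSums : ℕ → ℕ → Marking → Set
MarkingSums ℓ₁ ℓ₂ (t , b , _) = topSum t ≡ ℓ₁ × length t + ones b ≡ ℓ₂

row₁-marks : ∀ w → sum (map proj₁ (map entries w)) ≡ topSum (topMarks w)
row₁-marks []          = refl
row₁-marks (col11 ∷ w) = cong suc (row₁-marks w)
row₁-marks (col12 ∷ w) = cong suc (row₁-marks w)
row₁-marks (col21 ∷ w) = cong (λ s → suc (suc s)) (row₁-marks w)

row₂-marks : ∀ w → sum (map proj₂ (map entries w)) ≡ length (topMarks w) + ones (bottomMarks w)
row₂-marks []          = refl
row₂-marks (col11 ∷ w) = cong suc (row₂-marks w)
row₂-marks (col12 ∷ w) =
  cong suc (trans (cong suc (row₂-marks w))
                  (sym (+-suc (length (topMarks w)) (ones (bottomMarks w)))))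
row₂-marks (col21 ∷ w) = cong suc (row₂-marks w)

words↔markings : ∀ ℓ₁ ℓ₂ → Words ℓ₁ ℓ₂ ↔ Σ Marking (MarkingSums ℓ₁ ℓ₂)
words↔markings ℓ₁ ℓ₂ =
  Σ-↔ word↔marking λ {w} → ≡-subject-↔ (row₁-marks w) ×-↔ ≡-subject-↔ (row₂-marks w)

Graded : ℕ → ℕ → ℕ → Set
Graded ℓ₁ ℓ₂ k = Σ Marking λ m → length (proj₁ m) ≡ k × MarkingSums ℓ₁ ℓ₂ m

graded-≡ : ∀ {ℓ₁ ℓ₂ k} {x y : Graded ℓ₁ ℓ₂ k} →
           proj₁ (proj₁ x) ≡ proj₁ (proj₁ y) →
           proj₁ (proj₂ (proj₁ x)) ≡ proj₁ (proj₂ (proj₁ y)) → x ≡ y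
graded-≡ top≡ bottom≡ =
  subtype-≡ (×-irrelevant ≡-irrelevant (×-irrelevant ≡-irrelevant ≡-irrelevant))
            (marking-≡ top≡ bottom≡)

topSum+ones : ∀ t → topSum t + ones t ≡ 2 * length t
topSum+ones []          = refl
topSum+ones (true  ∷ t) = cong suc (trans (+-suc (topSum t) (ones t))
  (trans (cong suc (topSum+ones t)) (sym (+-suc (length t) (length t + 0)))))
topSum+ones (false ∷ t) =
  cong suc (trans (cong suc (topSum+ones t)) (sym (+-suc (length t) (length t + 0))))

-- Hence a graded marking has ℓ₁ ≤ 2k (top-row entries are at most 2) and
-- k ≤ ℓ₂ (bottom-row entries are at least 1).
graded-bounds : ∀ {ℓ₁ ℓ₂ k} → Graded ℓ₁ ℓ₂ k → ℓ₁ ≤ 2 * k × k ≤ ℓ₂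
graded-bounds ((t , b , _) , refl , refl , refl) =
  ≤-trans (m≤m+n (topSum t) (ones t)) (≤-reflexive (topSum+ones t)) , m≤m+n (length t) (ones b)

+≡⇒≡∸ : ∀ {a b c} → c + b ≡ a → b ≡ a ∸ c
+≡⇒≡∸ {b = b} {c} c+b≡a = trans (sym (m+n∸m≡n c b)) (cong (_∸ c) c+b≡a)

≡∸⇒+≡ : ∀ {a b c} → c ≤ a → b ≡ a ∸ c → c + b ≡ a
≡∸⇒+≡ {c = c} c≤a b≡a∸c = trans (cong (λ x → c + x) b≡a∸c) (m+[n∸m]≡n c≤a)

topSum⇒ones : ∀ {ℓ₁ k} t → length t ≡ k → topSum t ≡ ℓ₁ → ones t ≡ 2 * k ∸ ℓ₁
topSum⇒ones t refl refl = +≡⇒≡∸ (topSum+ones t)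

ones⇒topSum : ∀ {ℓ₁ k} t → length t ≡ k → ℓ₁ ≤ 2 * k → ones t ≡ 2 * k ∸ ℓ₁ → topSum t ≡ ℓ₁
ones⇒topSum {ℓ₁} t refl ℓ₁≤2k ones≡ =
  +-cancelʳ-≡ (ones t) (topSum t) ℓ₁ (trans (topSum+ones t) (sym (≡∸⇒+≡ ℓ₁≤2k ones≡)))

bitStrings↔graded : ∀ {ℓ₁ ℓ₂ k} → ℓ₁ ≤ 2 * k → k ≤ ℓ₂ →
  (BitStrings k (2 * k ∸ ℓ₁) × BitStrings (2 * k ∸ ℓ₁) (ℓ₂ ∸ k)) ↔ Graded ℓ₁ ℓ₂ k
bitStrings↔graded {ℓ₁} {ℓ₂} {k} ℓ₁≤2k k≤ℓ₂ =
  mk↔ₛ′ to from (λ _ → graded-≡ refl refl) (λ _ → cong₂ _,_ (bitStrings-≡ refl) (bitStrings-≡ refl))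
  where
  to : BitStrings k (2 * k ∸ ℓ₁) × BitStrings (2 * k ∸ ℓ₁) (ℓ₂ ∸ k) → Graded ℓ₁ ℓ₂ k
  to ((t , len-t , ones-t) , (b , len-b , ones-b)) =
    (t , b , trans len-b (sym ones-t)) , len-t , ones⇒topSum t len-t ℓ₁≤2k ones-t ,
    trans (cong (_+ ones b) len-t) (≡∸⇒+≡ k≤ℓ₂ ones-b)
  from : Graded ℓ₁ ℓ₂ k → BitStrings k (2 * k ∸ ℓ₁) × BitStrings (2 * k ∸ ℓ₁) (ℓ₂ ∸ k)
  from ((t , b , len-b) , len-t , row₁ , row₂) =
    (t , len-t , topSum⇒ones t len-t row₁) ,
    (b , trans len-b (topSum⇒ones t len-t row₁) , +≡⇒≡∸ (trans (cong (_+ ones b) (sym len-t)) row₂))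

summand : ℕ → ℕ → ℕ → ℕ
summand ℓ₁ ℓ₂ k = binomℤ (+ k) (+ (2 * k) ℤ.- + ℓ₁) * binomℤ (+ (2 * k) ℤ.- + ℓ₁) (+ ℓ₂ ℤ.- + k)

minus-nonneg : ∀ {m n} → n ≤ m → + m ℤ.- + n ≡ + (m ∸ n)
minus-nonneg {m} {n} n≤m = trans (ℤ.[+m]-[+n]≡m⊖n m n) (ℤ.⊖-≥ n≤m)

binomℤ-negative : ∀ n {a b} → a < b → binomℤ (+ n) (+ a ℤ.- + b) ≡ 0
binomℤ-negative n {a} {b} a<b rewrite ℤ.[+m]-[+n]≡m⊖n a b | ℤ.⊖-< a<b
  with b ∸ a | m<n⇒0<n∸m a<b
... | zero  | ()
... | suc _ | _ = refl

summand-vanishesˡ : ∀ {ℓ₁ ℓ₂ k} → 2 * k < ℓ₁ → summand ℓ₁ ℓ₂ k ≡ 0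
summand-vanishesˡ {ℓ₁} {ℓ₂} {k} 2k<ℓ₁ =
  cong (_* binomℤ (+ (2 * k) ℤ.- + ℓ₁) (+ ℓ₂ ℤ.- + k)) (binomℤ-negative k 2k<ℓ₁)

summand-vanishesʳ : ∀ {ℓ₁ ℓ₂ k} → ℓ₁ ≤ 2 * k → ℓ₂ < k → summand ℓ₁ ℓ₂ k ≡ 0
summand-vanishesʳ {ℓ₁} {ℓ₂} {k} ℓ₁≤2k ℓ₂<k rewrite minus-nonneg ℓ₁≤2k =
  trans (cong ((k C (2 * k ∸ ℓ₁)) *_) (binomℤ-negative (2 * k ∸ ℓ₁) ℓ₂<k))
        (*-zeroʳ (k C (2 * k ∸ ℓ₁)))

summand-value : ∀ {ℓ₁ ℓ₂ k} → ℓ₁ ≤ 2 * k → k ≤ ℓ₂ →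
                summand ℓ₁ ℓ₂ k ≡ (k C (2 * k ∸ ℓ₁)) * ((2 * k ∸ ℓ₁) C (ℓ₂ ∸ k))
summand-value {k = k} ℓ₁≤2k k≤ℓ₂ =
  cong₂ (λ x y → binomℤ (+ k) x * binomℤ x y) (minus-nonneg ℓ₁≤2k) (minus-nonneg k≤ℓ₂)

summand-↔ : ∀ ℓ₁ ℓ₂ k → Fin (summand ℓ₁ ℓ₂ k) ↔ Graded ℓ₁ ℓ₂ k
summand-↔ ℓ₁ ℓ₂ k with ℓ₁ ≤? 2 * k | k ≤? ℓ₂
... | no ℓ₁≰2k | _ =
  ↔-trans (Fin-cong (summand-vanishesˡ (≰⇒> ℓ₁≰2k))) (empty-↔ λ g → ℓ₁≰2k (proj₁ (graded-bounds g)))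
... | yes ℓ₁≤2k | no k≰ℓ₂ =
  ↔-trans (Fin-cong (summand-vanishesʳ ℓ₁≤2k (≰⇒> k≰ℓ₂))) (empty-↔ λ g → k≰ℓ₂ (proj₂ (graded-bounds g)))
... | yes ℓ₁≤2k | yes k≤ℓ₂ = begin
  Fin (summand ℓ₁ ℓ₂ k)                                      ↔⟨ Fin-cong (summand-value ℓ₁≤2k k≤ℓ₂) ⟩
  Fin ((k C (2 * k ∸ ℓ₁)) * ((2 * k ∸ ℓ₁) C (ℓ₂ ∸ k)))       ↔⟨ *↔× ⟩
  (Fin (k C (2 * k ∸ ℓ₁)) × Fin ((2 * k ∸ ℓ₁) C (ℓ₂ ∸ k)))   ↔⟨ bitStrings-↔ _ _ ×-↔ bitStrings-↔ _ _ ⟩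
  (BitStrings k (2 * k ∸ ℓ₁) × BitStrings (2 * k ∸ ℓ₁) (ℓ₂ ∸ k)) ↔⟨ bitStrings↔graded ℓ₁≤2k k≤ℓ₂ ⟩
  Graded ℓ₁ ℓ₂ k                                             ∎

markings-by-length : ∀ ℓ₁ ℓ₂ → Σ Marking (MarkingSums ℓ₁ ℓ₂) ↔ Σ ℕ (λ k → k ≤ ℓ₁ × Graded ℓ₁ ℓ₂ k)
markings-by-length ℓ₁ ℓ₂ = partition-↔ (λ m → length (proj₁ m)) (MarkingSums ℓ₁ ℓ₂) bounded
  where
  length≤topSum : ∀ t → length t ≤ topSum t
  length≤topSum []          = z≤n
  length≤topSum (true  ∷ t) = s≤s (length≤topSum t)
  length≤topSum (false ∷ t) = s≤s (m≤n⇒m≤1+n (length≤topSum t))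
  bounded : ∀ m → MarkingSums ℓ₁ ℓ₂ m → length (proj₁ m) ≤ ℓ₁
  bounded (t , _ , _) (refl , _) = length≤topSum t

mainTheorem5 : (ℓ₁ ℓ₂ : ℕ) → Fin (rhs ℓ₁ ℓ₂) ↔ Mat S₀ ℓ₁ ℓ₂
mainTheorem5 ℓ₁ ℓ₂ = begin
  Fin (rhs ℓ₁ ℓ₂)                                ↔⟨ sumUpTo-↔ ℓ₁ (summand ℓ₁ ℓ₂) ⟩
  Σ ℕ (λ k → k ≤ ℓ₁ × Fin (summand ℓ₁ ℓ₂ k))    ↔⟨ Σ-↔ ↔-refl (↔-refl ×-↔ summand-↔ ℓ₁ ℓ₂ _) ⟩
  Σ ℕ (λ k → k ≤ ℓ₁ × Graded ℓ₁ ℓ₂ k)           ↔⟨ markings-by-length ℓ₁ ℓ₂ ⟨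
  Σ Marking (MarkingSums ℓ₁ ℓ₂)                  ↔⟨ words↔markings ℓ₁ ℓ₂ ⟨
  Words ℓ₁ ℓ₂                                     ↔⟨ words↔matrices ℓ₁ ℓ₂ ⟩
  Mat S₀ ℓ₁ ℓ₂                                    ∎
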